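{- Let $\rho_0$ be a positive integer and $k\ge 0$ an integer. For $d=1,\dots,\rho_0$ define $q_{d,k}(t)$ by $$\sum_{s=0}^\infty (d+\rho_0 s)^k\, t^{d+\rho_0 s} = \frac{q_{d,k}(t)}{(1-t^{\rho_0})^{k+1}}.$$ Then each $q_{d,k}(t)$ is a polynomial, and for every $j=0,1,\dots,k$, the $j$-th derivatives at $t=1$ satisfy $$0\neq q_{1,k}^{(j)}(1) = q_{2,k}^{(j)}(1) = \cdots = q_{\rho_0,k}^{(j)}(1).$$
   Context: In the paper $\rho_0$ is the lcm period of an integer matrix, but the statement concerns only the positive integer $\rho_0$. -}

module Defs where

open import Data.Nat as ℕ using (ℕ; zero; suc; _∸_; _≤?_)
open import Data.Nat.Divisibility using (_∣?_)
open import Data.Integer using (ℤ; +_; -_; _+_; _*_; 0ℤ; 1ℤ)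
open import Relation.Nullary using (yes; no)

PS : Set
PS = ℕ → ℤ

Σ< : ℕ → (ℕ → ℤ) → ℤ
Σ< zero    f = 0ℤ
Σ< (suc n) f = Σ< n f + f n

_·_ : PS → PS → PS
(a · b) n = Σ< (suc n) (λ i → a i * b (n ∸ i))

onePS : PS
onePS zero    = 1ℤ
onePS (suc n) = 0ℤ

_^PS_ : PS → ℕ → PS
a ^PS zero  = onePS
a ^PS suc m = a · (a ^PS m)

-- The polynomial 1 - t^ρ (for ρ ≥ 1) as a power series.
oneMinusTPow : ℕ → PS
oneMinusTPow ρ n with n ℕ.≟ 0 | n ℕ.≟ ρ
... | yes _ | _     = 1ℤ
... | no _  | yes _ = - 1ℤ
... | no _  | no _  = 0ℤ

-- F_{ρ,d,k}(t) = Σ_{s ≥ 0} (d + ρ s)^k t^{d + ρ s}: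
-- coefficient of t^n is n^k if n = d + ρ s for some s ≥ 0, else 0.
F : ℕ → ℕ → ℕ → PS
F ρ d k n with d ≤? n | ρ ∣? (n ∸ d)
... | yes _ | yes _ = + (n ℕ.^ k)
... | _     | _     = 0ℤ

-- q_{d,k}(t) := (1 - t^ρ)^{k+1} · F_{ρ,d,k}(t), the unique power series
-- with F = q / (1 - t^ρ)^{k+1}.
q : ℕ → ℕ → ℕ → PS
q ρ d k = (oneMinusTPow ρ ^PS suc k) · F ρ d k

ff : ℕ → ℕ → ℕ
ff n zero    = 1
ff n (suc j) = ff n j ℕ.* (n ∸ j)

-- j-th derivative at t = 1 of the polynomial Σ_{n < N} p_n t^n
deriv1 : ℕ → PS → ℕ → ℤ
deriv1 N p j = Σ< N (λ n → + ff n j * p n)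

-- With M X = X - t^ρ X and θ = t d/dt, the series B_k = q_{d,k} = M^{k+1} F_{d,k}
-- satisfy B_0 = t^d and B_{k+1} = M (θ B_k) + (k+1) ρ t^ρ B_k, so B_k vanishes from
-- degree d + 1 + kρ on.  A derivative at 1 is a moment Σ_n p(n) B_k(n) against the
-- falling factorial p; moving M, θ and t^ρ onto the weight gives
--   Σ_n p(n) B_k(n) = (C_k p)(d),  C_k = T_0 ∘ ... ∘ T_{k-1},
--   (T_i p)(n) = n (p(n) - p(n+ρ)) + (i+1) ρ p(n+ρ).
-- Each T_i lowers the degree of a weight (measured by finite differences), so
-- C_k p is constant for deg p ≤ k; and T_i keeps values at multiples of ρ
-- nonnegative, so (C_k p)(0) > 0.  The file first develops sums, shifts, the
-- Cauchy product, θ, supports, moments, finite differences and falling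
-- factorials; then, for a fixed period ρ, the operators M, T_i, C_k; then the theorem.
module Submission where

open import Defs
open import Data.Nat using (ℕ; _≤_)
open import Data.Integer using (ℤ; 0ℤ)
open import Data.Product using (Σ; _×_)
open import Relation.Binary.PropositionalEquality using (_≡_; _≢_)

open import Data.Nat using (zero; suc; _<_; z≤n; s≤s; _∸_; _≤?_; NonZero; >-nonZero; >-nonZero⁻¹; ≢-nonZero⁻¹) renaming (_+_ to _+ℕ_; _*_ to _*ℕ_; _^_ to _^ℕ_; _≟_ to _≟ℕ_)
import Data.Nat.Properties as ℕP
open import Data.Nat.Divisibility using (_∣_; _∣?_; ∣-refl; ∣m∣n⇒∣m+n; ∣m+n∣m⇒∣n; _∣0; >⇒∤)
open import Data.Integer using (1ℤ; +_; -_; _+_; _*_; _-_)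
import Data.Integer.Properties as ℤP
open import Data.Integer.Tactic.RingSolver using (solve-∀)
open import Data.Product using (_,_; ∃)
open import Data.Sum using (inj₁; inj₂)
open import Data.Empty using (⊥-elim)
open import Relation.Nullary using (yes; no; ¬_)
open import Relation.Binary.PropositionalEquality using (refl; sym; trans; cong; cong₂; subst; _≗_; module ≡-Reasoning)

Σ-cong : ∀ n {f g : ℕ → ℤ} → f ≗ g → Σ< n f ≡ Σ< n g
Σ-cong zero    h = refl
Σ-cong (suc n) h = cong₂ _+_ (Σ-cong n h) (h n)

Σ-zero : ∀ n {f : ℕ → ℤ} → (∀ i → i < n → f i ≡ 0ℤ) → Σ< n f ≡ 0ℤ
Σ-zero zero    h = refl
Σ-zero (suc n) h = cong₂ _+_ (Σ-zero n (λ i i<n → h i (ℕP.m<n⇒m<1+n i<n))) (h n ℕP.≤-refl)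

Σ-affine : ∀ n c (f g : ℕ → ℤ) → Σ< n (λ i → f i + c * g i) ≡ Σ< n f + c * Σ< n g
Σ-affine zero    c f g = sym (trans (ℤP.+-identityˡ _) (ℤP.*-zeroʳ c))
Σ-affine (suc n) c f g =
  trans (cong (_+ (f n + c * g n)) (Σ-affine n c f g)) (step (Σ< n f) (Σ< n g) (f n) (g n) c)
  where
    step : ∀ a b x y c → (a + c * b) + (x + c * y) ≡ (a + x) + c * (b + y)
    step = solve-∀

Σ-sub : ∀ n (f g : ℕ → ℤ) → Σ< n (λ i → f i - g i) ≡ Σ< n f - Σ< n g
Σ-sub zero    f g = refl
Σ-sub (suc n) f g =
  trans (cong (_+ (f n - g n)) (Σ-sub n f g)) (step (Σ< n f) (Σ< n g) (f n) (g n))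
  where
    step : ∀ a b x y → (a - b) + (x - y) ≡ (a + x) - (b + y)
    step = solve-∀

Σ-split : ∀ m n (f : ℕ → ℤ) → Σ< (m +ℕ n) f ≡ Σ< m f + Σ< n (λ i → f (m +ℕ i))
Σ-split m zero    f rewrite ℕP.+-identityʳ m = sym (ℤP.+-identityʳ _)
Σ-split m (suc n) f rewrite ℕP.+-suc m n =
  trans (cong (_+ f (m +ℕ n)) (Σ-split m n f)) (ℤP.+-assoc (Σ< m f) _ (f (m +ℕ n)))

shift : ℕ → PS → PS
shift zero    X n       = X n
shift (suc r) X zero    = 0ℤ
shift (suc r) X (suc n) = shift r X n

shift-below : ∀ r X n → n < r → shift r X n ≡ 0ℤ
shift-below (suc r) X zero    _       = refl
shift-below (suc r) X (suc n) (s≤s p) = shift-below r X n p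

shift-at : ∀ r X m → shift r X (r +ℕ m) ≡ X m
shift-at zero    X m = refl
shift-at (suc r) X m = shift-at r X m

shift-cong : ∀ r {X Y : PS} → X ≗ Y → shift r X ≗ shift r Y
shift-cong zero    h n       = h n
shift-cong (suc r) h zero    = refl
shift-cong (suc r) h (suc n) = shift-cong r h n

data Position (r : ℕ) : ℕ → Set where
  below : ∀ {n} → n < r → Position r n
  above : ∀ m → Position r (r +ℕ m)

position : ∀ r n → Position r n
position zero    n       = above n
position (suc r) zero    = below (s≤s z≤n)
position (suc r) (suc n) with position r n
... | below p = below (s≤s p)
... | above m = above m

shift-vanish : ∀ r X n → (∀ m → r +ℕ m ≡ n → X m ≡ 0ℤ) → shift r X n ≡ 0ℤ
shift-vanish r X n h with position r n
... | below p = shift-below r X n p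
... | above m = trans (shift-at r X m) (h m refl)

shift-map₂ : ∀ r (op : ℤ → ℤ → ℤ) → op 0ℤ 0ℤ ≡ 0ℤ → ∀ X Y →
             shift r (λ i → op (X i) (Y i)) ≗ (λ n → op (shift r X n) (shift r Y n))
shift-map₂ zero    op e X Y n       = refl
shift-map₂ (suc r) op e X Y zero    = sym e
shift-map₂ (suc r) op e X Y (suc n) = shift-map₂ r op e X Y n

·-congˡ : ∀ {a a' : PS} (b : PS) → a ≗ a' → (a · b) ≗ (a' · b)
·-congˡ b h n = Σ-cong (suc n) (λ i → cong (_* b (n ∸ i)) (h i))

·-subˡ : ∀ (a a' b : PS) → ((λ i → a i - a' i) · b) ≗ (λ n → (a · b) n - (a' · b) n)
·-subˡ a a' b n = trans (Σ-cong (suc n) (λ i → distrib (a i) (a' i) (b (n ∸ i)))) (Σ-sub (suc n) _ _)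
  where
    distrib : ∀ x y z → (x - y) * z ≡ x * z - y * z
    distrib = solve-∀

·-shiftˡ : ∀ r (a b : PS) → (shift r a · b) ≗ shift r (a · b)
·-shiftˡ r a b n with position r n
... | below p = trans (Σ-zero (suc n) (λ i i≤n → killed i (ℕP.<-≤-trans i≤n p))) (sym (shift-below r (a · b) n p))
  where
    killed : ∀ i → i < r → shift r a i * b (n ∸ i) ≡ 0ℤ
    killed i i<r = trans (cong (_* b (n ∸ i)) (shift-below r a i i<r)) (ℤP.*-zeroˡ (b (n ∸ i)))
... | above m = begin
    Σ< (suc (r +ℕ m)) f                              ≡⟨ cong (λ x → Σ< x f) (sym (ℕP.+-suc r m)) ⟩
    Σ< (r +ℕ suc m) f                                ≡⟨ Σ-split r (suc m) f ⟩
    Σ< r f + Σ< (suc m) (λ i → f (r +ℕ i))           ≡⟨ cong₂ _+_ (Σ-zero r killed) (Σ-cong (suc m) shifted) ⟩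
    0ℤ + (a · b) m                                   ≡⟨ ℤP.+-identityˡ _ ⟩
    (a · b) m                                        ≡⟨ sym (shift-at r (a · b) m) ⟩
    shift r (a · b) (r +ℕ m)                         ∎
  where
    open ≡-Reasoning
    f : ℕ → ℤ
    f i = shift r a i * b (r +ℕ m ∸ i)
    killed : ∀ i → i < r → f i ≡ 0ℤ
    killed i i<r = trans (cong (_* b (r +ℕ m ∸ i)) (shift-below r a i i<r)) (ℤP.*-zeroˡ (b (r +ℕ m ∸ i)))
    shifted : ∀ i → f (r +ℕ i) ≡ a i * b (m ∸ i)
    shifted i = cong₂ _*_ (shift-at r a i) (cong b (ℕP.[m+n]∸[m+o]≡n∸o r m i))

onePS-· : ∀ (b : PS) → (onePS · b) ≗ b
onePS-· b n = begin
    Σ< (suc n) f                                     ≡⟨ Σ-split 1 n f ⟩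
    (0ℤ + 1ℤ * b n) + Σ< n (λ i → f (suc i))         ≡⟨ cong₂ _+_ (trans (ℤP.+-identityˡ _) (ℤP.*-identityˡ (b n))) (Σ-zero n (λ i _ → ℤP.*-zeroˡ (b (n ∸ suc i)))) ⟩
    b n + 0ℤ                                         ≡⟨ ℤP.+-identityʳ _ ⟩
    b n                                              ∎
  where
    open ≡-Reasoning
    f : ℕ → ℤ
    f i = onePS i * b (n ∸ i)

onePS-nonzero : ∀ {n} → n ≢ 0 → onePS n ≡ 0ℤ
onePS-nonzero {zero}  n≢0 = ⊥-elim (n≢0 refl)
onePS-nonzero {suc n} _   = refl

-- The Euler operator θ = t d/dt; it commutes with t^r up to r t^r.

θ : PS → PS
θ X n = + n * X n

shift-θ : ∀ r X n → shift r (θ X) n ≡ θ (shift r X) n - + r * shift r X n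
shift-θ r X n with position r n
... | below p rewrite shift-below r X n p | shift-below r (θ X) n p
                    | ℤP.*-zeroʳ (+ n) | ℤP.*-zeroʳ (+ r) = refl
... | above m rewrite shift-at r X m | shift-at r (θ X) m | ℤP.pos-+ r m = expand (+ r) (+ m) (X m)
  where
    expand : ∀ r m x → m * x ≡ (r + m) * x - r * x
    expand = solve-∀

VanishesFrom : ℕ → PS → Set
VanishesFrom N X = ∀ n → N ≤ n → X n ≡ 0ℤ

onePS-vanishes : VanishesFrom 1 onePS
onePS-vanishes (suc n) _ = refl

vanish-shift : ∀ r N X → VanishesFrom N X → VanishesFrom (r +ℕ N) (shift r X)
vanish-shift r N X v n le = shift-vanish r X n (λ m e → v m (ℕP.+-cancelˡ-≤ r N m (subst (r +ℕ N ≤_) (sym e) le)))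

vanish-θ : ∀ N X → VanishesFrom N X → VanishesFrom N (θ X)
vanish-θ N X v n le rewrite v n le = ℤP.*-zeroʳ (+ n)

-- Moments Σ_{n<N} p(n) X(n) of a series against a weight p.  The j-th
-- derivative at 1 is the moment against the falling factorial of order j.

moment : ℕ → (ℕ → ℤ) → PS → ℤ
moment N p X = Σ< N (λ n → p n * X n)

moment-cong : ∀ N p {X Y : PS} → X ≗ Y → moment N p X ≡ moment N p Y
moment-cong N p h = Σ-cong N (λ i → cong (p i *_) (h i))

moment-truncate : ∀ {N N'} p (X : PS) → VanishesFrom N X → N ≤ N' → moment N' p X ≡ moment N p X
moment-truncate {N} p X v N≤N' with ℕP.m≤n⇒∃[o]m+o≡n N≤N'
... | r , refl = trans (Σ-split N r _) (trans (cong (λ z → moment N p X + z) (Σ-zero r beyond)) (ℤP.+-identityʳ _))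
  where
    beyond : ∀ i → i < r → p (N +ℕ i) * X (N +ℕ i) ≡ 0ℤ
    beyond i _ = trans (cong (p (N +ℕ i) *_) (v (N +ℕ i) (ℕP.m≤m+n N i))) (ℤP.*-zeroʳ (p (N +ℕ i)))

moment-shift : ∀ r N p (X : PS) → moment (r +ℕ N) p (shift r X) ≡ moment N (λ n → p (r +ℕ n)) X
moment-shift r N p X = trans (Σ-split r N _) (trans (cong₂ _+_ (Σ-zero r low) (Σ-cong N high)) (ℤP.+-identityˡ _))
  where
    low : ∀ i → i < r → p i * shift r X i ≡ 0ℤ
    low i i<r = trans (cong (p i *_) (shift-below r X i i<r)) (ℤP.*-zeroʳ (p i))
    high : ∀ i → p (r +ℕ i) * shift r X (r +ℕ i) ≡ p (r +ℕ i) * X i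
    high i = cong (p (r +ℕ i) *_) (shift-at r X i)

moment-θ : ∀ N p (X : PS) → moment N p (θ X) ≡ moment N (λ n → + n * p n) X
moment-θ N p X = Σ-cong N (λ n → swap (p n) (+ n) (X n))
  where
    swap : ∀ a n x → a * (n * x) ≡ (n * a) * x
    swap = solve-∀

moment-affine : ∀ N p c (X Y : PS) → moment N p (λ n → X n + c * Y n) ≡ moment N p X + c * moment N p Y
moment-affine N p c X Y = trans (Σ-cong N (λ n → distrib (p n) (X n) (Y n) c)) (Σ-affine N c _ _)
  where
    distrib : ∀ a x y c → a * (x + c * y) ≡ a * x + c * (a * y)
    distrib = solve-∀

moment-sub : ∀ N p (X Y : PS) → moment N p (λ n → X n - Y n) ≡ moment N p X - moment N p Y
moment-sub N p X Y = trans (Σ-cong N (λ n → distrib (p n) (X n) (Y n))) (Σ-sub N _ _)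
  where
    distrib : ∀ a x y → a * (x - y) ≡ a * x - a * y
    distrib = solve-∀

weight-affine : ∀ N c (p p' : ℕ → ℤ) X → moment N (λ n → p n + c * p' n) X ≡ moment N p X + c * moment N p' X
weight-affine N c p p' X = trans (Σ-cong N (λ n → distrib (p n) (p' n) (X n) c)) (Σ-affine N c _ _)
  where
    distrib : ∀ a b x c → (a + c * b) * x ≡ a * x + c * (b * x)
    distrib = solve-∀

weight-sub : ∀ N (p p' : ℕ → ℤ) X → moment N (λ n → p n - p' n) X ≡ moment N p X - moment N p' X
weight-sub N p p' X = trans (Σ-cong N (λ n → distrib (p n) (p' n) (X n))) (Σ-sub N _ _)
  where
    distrib : ∀ a b x → (a - b) * x ≡ a * x - b * x
    distrib = solve-∀

Δ : (ℕ → ℤ) → ℕ → ℤ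
Δ f n = f (suc n) - f n

Δ^ : ℕ → (ℕ → ℤ) → ℕ → ℤ
Δ^ zero    f = f
Δ^ (suc m) f = Δ (Δ^ m f)

DegreeAtMost : ℕ → (ℕ → ℤ) → Set
DegreeAtMost k p = ∀ n → Δ^ (suc k) p n ≡ 0ℤ

Δ^-cong : ∀ m {f g : ℕ → ℤ} → f ≗ g → Δ^ m f ≗ Δ^ m g
Δ^-cong zero    h n = h n
Δ^-cong (suc m) h n = cong₂ _-_ (Δ^-cong m h (suc n)) (Δ^-cong m h n)

Δ^-+ : ∀ m (f g : ℕ → ℤ) → Δ^ m (λ i → f i + g i) ≗ (λ n → Δ^ m f n + Δ^ m g n)
Δ^-+ zero    f g n = refl
Δ^-+ (suc m) f g n =
  trans (cong₂ _-_ (Δ^-+ m f g (suc n)) (Δ^-+ m f g n)) (regroup (Δ^ m f (suc n)) (Δ^ m g (suc n)) (Δ^ m f n) (Δ^ m g n))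
  where
    regroup : ∀ a b c d → (a + b) - (c + d) ≡ (a - c) + (b - d)
    regroup = solve-∀

Δ^-sub : ∀ m (f g : ℕ → ℤ) → Δ^ m (λ i → f i - g i) ≗ (λ n → Δ^ m f n - Δ^ m g n)
Δ^-sub zero    f g n = refl
Δ^-sub (suc m) f g n =
  trans (cong₂ _-_ (Δ^-sub m f g (suc n)) (Δ^-sub m f g n)) (regroup (Δ^ m f (suc n)) (Δ^ m g (suc n)) (Δ^ m f n) (Δ^ m g n))
  where
    regroup : ∀ a b c d → (a - b) - (c - d) ≡ (a - c) - (b - d)
    regroup = solve-∀

Δ^-scale : ∀ m c (f : ℕ → ℤ) → Δ^ m (λ i → c * f i) ≗ (λ n → c * Δ^ m f n)
Δ^-scale zero    c f n = refl
Δ^-scale (suc m) c f n =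
  trans (cong₂ _-_ (Δ^-scale m c f (suc n)) (Δ^-scale m c f n)) (factor c (Δ^ m f (suc n)) (Δ^ m f n))
  where
    factor : ∀ c a b → c * a - c * b ≡ c * (a - b)
    factor = solve-∀

Δ^-translate : ∀ m r (f : ℕ → ℤ) → Δ^ m (λ i → f (r +ℕ i)) ≗ (λ n → Δ^ m f (r +ℕ n))
Δ^-translate zero    r f n = refl
Δ^-translate (suc m) r f n =
  trans (cong₂ _-_ (Δ^-translate m r f (suc n)) (Δ^-translate m r f n)) (cong (λ z → Δ^ m f z - Δ^ m f (r +ℕ n)) (ℕP.+-suc r n))

Δ^-suc : ∀ m (f : ℕ → ℤ) → Δ^ (suc m) f ≗ Δ^ m (Δ f)
Δ^-suc zero    f n = refl
Δ^-suc (suc m) f n = cong₂ _-_ (Δ^-suc m f (suc n)) (Δ^-suc m f n)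

Leibniz : ∀ m (g : ℕ → ℤ) n → Δ^ (suc m) (λ i → + i * g i) n ≡ + n * Δ^ (suc m) g n + + suc m * Δ^ m g (suc n)
Leibniz zero    g n = trans (cong (λ z → z * g (suc n) - + n * g n) (ℤP.pos-+ 1 n)) (base (+ n) (g (suc n)) (g n))
  where
    base : ∀ n a b → (+ 1 + n) * a - n * b ≡ n * (a - b) + + 1 * a
    base = solve-∀
Leibniz (suc m) g n = begin
  Δ (Δ^ (suc m) (λ i → + i * g i)) n
    ≡⟨ cong₂ _-_ (Leibniz m g (suc n)) (Leibniz m g n) ⟩
  (+ suc n * b + c * Δ^ m g (suc (suc n))) - (+ n * Δ^ (suc m) g n + c * a)
    ≡⟨ cong (λ x → (x * b + c * Δ^ m g (suc (suc n))) - (+ n * Δ^ (suc m) g n + c * a)) (ℤP.pos-+ 1 n) ⟩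
  ((+ 1 + + n) * b + c * Δ^ m g (suc (suc n))) - (+ n * Δ^ (suc m) g n + c * a)
    ≡⟨ regroup (+ n) (Δ^ m g (suc (suc n))) a (Δ^ (suc m) g n) c ⟩
  + n * Δ^ (suc (suc m)) g n + (+ 1 + c) * b
    ≡⟨ cong (λ z → + n * Δ^ (suc (suc m)) g n + z * b) (sym (ℤP.pos-+ 1 (suc m))) ⟩
  + n * Δ^ (suc (suc m)) g n + + suc (suc m) * b ∎
  where
    open ≡-Reasoning
    a b c : ℤ
    a = Δ^ m g (suc n)
    b = Δ^ (suc m) g (suc n)
    c = + suc m
    regroup : ∀ N x y G c → ((+ 1 + N) * (x - y) + c * x) - (N * G + c * y) ≡ N * ((x - y) - G) + (+ 1 + c) * (x - y)
    regroup = solve-∀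

Δ-zero⇒constant : ∀ (G : ℕ → ℤ) → (∀ n → Δ G n ≡ 0ℤ) → ∀ n → G n ≡ G 0
Δ-zero⇒constant G h zero    = refl
Δ-zero⇒constant G h (suc n) = begin
  G (suc n)              ≡⟨ restore (G (suc n)) (G n) ⟩
  Δ G n + G n            ≡⟨ cong₂ _+_ (h n) (Δ-zero⇒constant G h n) ⟩
  0ℤ + G 0               ≡⟨ ℤP.+-identityˡ (G 0) ⟩
  G 0                    ∎
  where
    open ≡-Reasoning
    restore : ∀ a b → a ≡ (a - b) + b
    restore = solve-∀

Δ-constant⇒linear : ∀ (H : ℕ → ℤ) K → (∀ n → Δ H n ≡ K) → ∀ r x → H (r +ℕ x) ≡ H x + + r * K
Δ-constant⇒linear H K h zero    x = sym (trans (cong (λ z → H x + z) (ℤP.*-zeroˡ K)) (ℤP.+-identityʳ (H x)))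
Δ-constant⇒linear H K h (suc r) x = begin
  H (suc (r +ℕ x))                       ≡⟨ restore (H (suc (r +ℕ x))) (H (r +ℕ x)) ⟩
  Δ H (r +ℕ x) + H (r +ℕ x)              ≡⟨ cong₂ _+_ (h (r +ℕ x)) (Δ-constant⇒linear H K h r x) ⟩
  K + (H x + + r * K)                    ≡⟨ collect K (H x) (+ r) ⟩
  H x + (+ 1 + + r) * K                  ≡⟨ cong (λ z → H x + z * K) (sym (ℤP.pos-+ 1 r)) ⟩
  H x + + suc r * K                      ∎
  where
    open ≡-Reasoning
    restore : ∀ a b → a ≡ (a - b) + b
    restore = solve-∀
    collect : ∀ K h r → K + (h + r * K) ≡ h + (+ 1 + r) * K
    collect = solve-∀

degree-mono : ∀ {j k} p → j ≤ k → DegreeAtMost j p → DegreeAtMost k p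
degree-mono {j} p j≤k deg with ℕP.m≤n⇒∃[o]m+o≡n j≤k
... | r , refl = raise r
  where
    raise : ∀ r → DegreeAtMost (j +ℕ r) p
    raise zero    n rewrite ℕP.+-identityʳ j = deg n
    raise (suc r) n rewrite ℕP.+-suc j r | raise r (suc n) | raise r n = refl

-- Falling factorials n (n-1) ... (n-j+1): the weights computing j-th
-- derivatives at 1.  They satisfy Pascal's rule, hence have degree j.

fallingWeight : ℕ → ℕ → ℤ
fallingWeight j n = + ff n j

ff-vanishes : ∀ n j → n < j → ff n j ≡ 0
ff-vanishes n (suc j) (s≤s n≤j) with ℕP.m≤n⇒m<n∨m≡n n≤j
... | inj₁ n<j rewrite ff-vanishes n j n<j = refl
... | inj₂ refl rewrite ℕP.n∸n≡0 n = ℕP.*-zeroʳ (ff n n)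

ff-suc : ∀ n j → ff (suc n) (suc j) ≡ suc n *ℕ ff n j
ff-suc n zero    = trans (ℕP.*-identityˡ (suc n)) (sym (ℕP.*-identityʳ (suc n)))
ff-suc n (suc j) rewrite ff-suc n j = ℕP.*-assoc (suc n) (ff n j) (n ∸ j)

ff-pascal : ∀ n j → ff (suc n) (suc j) ≡ ff n (suc j) +ℕ suc j *ℕ ff n j
ff-pascal n j with ℕP.≤-<-connex j n
... | inj₂ n<j rewrite ff-suc n j | ff-vanishes n j n<j | ℕP.*-zeroʳ (suc n) | ℕP.*-zeroʳ (suc j) = refl
... | inj₁ j≤n rewrite ff-suc n j = begin
  suc n *ℕ ff n j                         ≡⟨ cong (_*ℕ ff n j) (sym (trans (ℕP.+-suc (n ∸ j) j) (cong suc (ℕP.m∸n+n≡m j≤n)))) ⟩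
  ((n ∸ j) +ℕ suc j) *ℕ ff n j            ≡⟨ ℕP.*-distribʳ-+ (ff n j) (n ∸ j) (suc j) ⟩
  (n ∸ j) *ℕ ff n j +ℕ suc j *ℕ ff n j    ≡⟨ cong (_+ℕ suc j *ℕ ff n j) (ℕP.*-comm (n ∸ j) (ff n j)) ⟩
  ff n j *ℕ (n ∸ j) +ℕ suc j *ℕ ff n j    ∎
  where open ≡-Reasoning

ff-positive : ∀ n j → j ≤ n → 0 < ff n j
ff-positive n zero    _    = s≤s z≤n
ff-positive n (suc j) j<n = ℕP.*-mono-≤ (ff-positive n j (ℕP.<⇒≤ j<n)) (ℕP.m<n⇒0<n∸m j<n)

Δ-fallingWeight : ∀ j → Δ (fallingWeight (suc j)) ≗ (λ n → + suc j * fallingWeight j n)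
Δ-fallingWeight j n = begin
  + ff (suc n) (suc j) - + ff n (suc j)                      ≡⟨ cong (λ z → + z - + ff n (suc j)) (ff-pascal n j) ⟩
  + (ff n (suc j) +ℕ suc j *ℕ ff n j) - + ff n (suc j)       ≡⟨ cong (λ z → z - + ff n (suc j)) (ℤP.pos-+ (ff n (suc j)) (suc j *ℕ ff n j)) ⟩
  (+ ff n (suc j) + + (suc j *ℕ ff n j)) - + ff n (suc j)    ≡⟨ cancel (+ ff n (suc j)) (+ (suc j *ℕ ff n j)) ⟩
  + (suc j *ℕ ff n j)                                        ≡⟨ ℤP.pos-* (suc j) (ff n j) ⟩
  + suc j * + ff n j                                         ∎
  where
    open ≡-Reasoning
    cancel : ∀ a b → (a + b) - a ≡ b
    cancel = solve-∀

fallingWeight-degree : ∀ j → DegreeAtMost j (fallingWeight j)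
fallingWeight-degree zero    n = refl
fallingWeight-degree (suc j) n = begin
  Δ^ (suc (suc j)) (fallingWeight (suc j)) n            ≡⟨ Δ^-suc (suc j) (fallingWeight (suc j)) n ⟩
  Δ^ (suc j) (Δ (fallingWeight (suc j))) n              ≡⟨ Δ^-cong (suc j) (Δ-fallingWeight j) n ⟩
  Δ^ (suc j) (λ i → + suc j * fallingWeight j i) n      ≡⟨ Δ^-scale (suc j) (+ suc j) (fallingWeight j) n ⟩
  + suc j * Δ^ (suc j) (fallingWeight j) n              ≡⟨ cong (+ suc j *_) (fallingWeight-degree j n) ⟩
  + suc j * 0ℤ                                          ≡⟨ ℤP.*-zeroʳ (+ suc j) ⟩
  0ℤ                                                    ∎
  where open ≡-Reasoning

positive⇒suc : ∀ {v} → 0 < v → ∃ λ c → v ≡ suc c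
positive⇒suc {suc c} _ = c , refl

-- Everything that depends on the period ρ.  Only the facts that use
-- t^ρ ≠ 1 carry the hypothesis NonZero ρ.
module Period (ρ : ℕ) where

  M : PS → PS
  M X n = X n - shift ρ X n

  M^ : ℕ → PS → PS
  M^ zero    X = X
  M^ (suc m) X = M (M^ m X)

  M-cong : ∀ {X Y : PS} → X ≗ Y → M X ≗ M Y
  M-cong h n = cong₂ _-_ (h n) (shift-cong ρ h n)

  M^-cong : ∀ m {X Y : PS} → X ≗ Y → M^ m X ≗ M^ m Y
  M^-cong zero    h = h
  M^-cong (suc m) h = M-cong (M^-cong m h)

  M-affine : ∀ c (X Y : PS) → M (λ i → X i + c * Y i) ≗ (λ n → M X n + c * M Y n)
  M-affine c X Y n =
    trans (cong (λ s → (X n + c * Y n) - s) (shift-map₂ ρ (λ x y → x + c * y) fixes0 X Y n))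
          (regroup (X n) (Y n) (shift ρ X n) (shift ρ Y n) c)
    where
      fixes0 : 0ℤ + c * 0ℤ ≡ 0ℤ
      fixes0 = trans (ℤP.+-identityˡ _) (ℤP.*-zeroʳ c)
      regroup : ∀ x y x' y' c → (x + c * y) - (x' + c * y') ≡ (x - x') + c * (y - y')
      regroup = solve-∀

  M-shift : ∀ X → shift ρ (M X) ≗ M (shift ρ X)
  M-shift X = shift-map₂ ρ _-_ refl X (shift ρ X)

  oneMinusTPow-shape : .{{_ : NonZero ρ}} → oneMinusTPow ρ ≗ (λ i → onePS i - shift ρ onePS i)
  oneMinusTPow-shape i with i ≟ℕ 0 | i ≟ℕ ρ
  ... | yes refl | _       = cong (λ z → 1ℤ - z) (sym (shift-below ρ onePS 0 (>-nonZero⁻¹ ρ)))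
  ... | no i≢0   | yes refl = sym (cong₂ _-_ (onePS-nonzero i≢0) atρ)
    where
      atρ : shift ρ onePS ρ ≡ 1ℤ
      atρ = trans (cong (shift ρ onePS) (sym (ℕP.+-identityʳ ρ))) (shift-at ρ onePS 0)
  ... | no i≢0   | no i≢ρ   = sym (cong₂ _-_ (onePS-nonzero i≢0) (shift-vanish ρ onePS i off))
    where
      off : ∀ m → ρ +ℕ m ≡ i → onePS m ≡ 0ℤ
      off zero    e = ⊥-elim (i≢ρ (trans (sym e) (ℕP.+-identityʳ ρ)))
      off (suc m) _ = refl

  M-product : .{{_ : NonZero ρ}} → ∀ Y → (oneMinusTPow ρ · Y) ≗ M Y
  M-product Y n = begin
    (oneMinusTPow ρ · Y) n                          ≡⟨ ·-congˡ Y oneMinusTPow-shape n ⟩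
    ((λ i → onePS i - shift ρ onePS i) · Y) n       ≡⟨ ·-subˡ onePS (shift ρ onePS) Y n ⟩
    (onePS · Y) n - (shift ρ onePS · Y) n           ≡⟨ cong₂ _-_ (onePS-· Y n) (·-shiftˡ ρ onePS Y n) ⟩
    Y n - shift ρ (onePS · Y) n                     ≡⟨ cong (λ z → Y n - z) (shift-cong ρ (onePS-· Y) n) ⟩
    M Y n                                           ∎
    where open ≡-Reasoning

  M^-power : .{{_ : NonZero ρ}} → ∀ m X → ((oneMinusTPow ρ ^PS m) · X) ≗ M^ m X
  M^-power zero    X n = onePS-· X n
  M^-power (suc m) X n = begin
    ((P · Pᵐ) · X) n                                ≡⟨ ·-congˡ X (M-product Pᵐ) n ⟩
    ((λ i → Pᵐ i - shift ρ Pᵐ i) · X) n             ≡⟨ ·-subˡ Pᵐ (shift ρ Pᵐ) X n ⟩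
    (Pᵐ · X) n - (shift ρ Pᵐ · X) n                 ≡⟨ cong (λ z → (Pᵐ · X) n - z) (·-shiftˡ ρ Pᵐ X n) ⟩
    M (Pᵐ · X) n                                    ≡⟨ M-cong (M^-power m X) n ⟩
    M^ (suc m) X n                                  ∎
    where
      open ≡-Reasoning
      P Pᵐ : PS
      P  = oneMinusTPow ρ
      Pᵐ = P ^PS m

  κ : ℕ → ℤ
  κ m = + (suc m *ℕ ρ)

  M-θ : ∀ X n → M (θ X) n ≡ θ (M X) n + + ρ * shift ρ X n
  M-θ X n rewrite shift-θ ρ X n = regroup (+ n) (X n) (shift ρ X n) (+ ρ)
    where
      regroup : ∀ n x s r → n * x - (n * s - r * s) ≡ n * (x - s) + r * s
      regroup = solve-∀

  M^-θ : ∀ m X → M^ (suc m) (θ X) ≗ (λ n → θ (M^ (suc m) X) n + κ m * shift ρ (M^ m X) n)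
  M^-θ zero    X n = trans (M-θ X n) (cong (λ c → θ (M X) n + + c * shift ρ X n) (sym (ℕP.*-identityˡ ρ)))
  M^-θ (suc m) X n = begin
    M (M^ (suc m) (θ X)) n                                    ≡⟨ M-cong (M^-θ m X) n ⟩
    M (λ i → θ Y i + κ m * shift ρ (M^ m X) i) n              ≡⟨ M-affine (κ m) (θ Y) _ n ⟩
    M (θ Y) n + κ m * M (shift ρ (M^ m X)) n                  ≡⟨ cong₂ (λ a b → a + κ m * b) (M-θ Y n) (sym (M-shift (M^ m X) n)) ⟩
    (θ (M Y) n + + ρ * shift ρ Y n) + κ m * shift ρ Y n       ≡⟨ collect (θ (M Y) n) (+ ρ) (κ m) (shift ρ Y n) ⟩
    θ (M Y) n + (+ ρ + κ m) * shift ρ Y n                     ≡⟨ cong (λ c → θ (M Y) n + c * shift ρ Y n) (sym (ℤP.pos-+ ρ (suc m *ℕ ρ))) ⟩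
    θ (M Y) n + κ (suc m) * shift ρ Y n                       ∎
    where
      open ≡-Reasoning
      Y : PS
      Y = M^ (suc m) X
      collect : ∀ a r c s → (a + r * s) + c * s ≡ a + (r + c) * s
      collect = solve-∀

  F-on : ∀ d k m → ρ ∣ m → F ρ d k (d +ℕ m) ≡ + ((d +ℕ m) ^ℕ k)
  F-on d k m ρ∣m with d ≤? d +ℕ m | ρ ∣? (d +ℕ m ∸ d)
  ... | yes _  | yes _ = refl
  ... | no d≰  | _     = ⊥-elim (d≰ (ℕP.m≤m+n d m))
  ... | yes _  | no ρ∤ = ⊥-elim (ρ∤ (subst (ρ ∣_) (sym (ℕP.m+n∸m≡n d m)) ρ∣m))

  F-off : ∀ d k m → ¬ ρ ∣ m → F ρ d k (d +ℕ m) ≡ 0ℤ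
  F-off d k m ρ∤m with d ≤? d +ℕ m | ρ ∣? (d +ℕ m ∸ d)
  ... | yes _ | yes ρ∣ = ⊥-elim (ρ∤m (subst (ρ ∣_) (ℕP.m+n∸m≡n d m) ρ∣))
  ... | no _  | _     = refl
  ... | yes _ | no _  = refl

  F-below : ∀ d k n → n < d → F ρ d k n ≡ 0ℤ
  F-below d k n n<d with d ≤? n | ρ ∣? (n ∸ d)
  ... | yes d≤n | yes _ = ⊥-elim (ℕP.<⇒≱ n<d d≤n)
  ... | no _    | _     = refl
  ... | yes _   | no _  = refl

  θ-F : ∀ d k → θ (F ρ d k) ≗ F ρ d (suc k)
  θ-F d k n with d ≤? n | ρ ∣? (n ∸ d)
  ... | yes _ | yes _ = sym (ℤP.pos-* n (n ^ℕ k))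
  ... | no _  | _     = ℤP.*-zeroʳ (+ n)
  ... | yes _ | no _  = ℤP.*-zeroʳ (+ n)

  F₀-periodic : ∀ d m → F ρ d 0 (d +ℕ (ρ +ℕ m)) ≡ F ρ d 0 (d +ℕ m)
  F₀-periodic d m with ρ ∣? m
  ... | yes ρ∣m = trans (F-on d 0 (ρ +ℕ m) (∣m∣n⇒∣m+n ∣-refl ρ∣m)) (sym (F-on d 0 m ρ∣m))
  ... | no ρ∤m  = trans (F-off d 0 (ρ +ℕ m) (λ ρ∣ρ+m → ρ∤m (∣m+n∣m⇒∣n ρ∣ρ+m ∣-refl))) (sym (F-off d 0 m ρ∤m))

  F₀-initial : .{{_ : NonZero ρ}} → ∀ d m → m < ρ → F ρ d 0 (d +ℕ m) ≡ onePS m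
  F₀-initial d zero    _   = F-on d 0 0 (ρ ∣0)
  F₀-initial d (suc m) m<ρ = F-off d 0 (suc m) (>⇒∤ m<ρ)

  B : ℕ → ℕ → PS
  B d k = M^ (suc k) (F ρ d k)

  q≗B : .{{_ : NonZero ρ}} → ∀ d k → q ρ d k ≗ B d k
  q≗B d k = M^-power (suc k) (F ρ d k)

  B-initial : .{{_ : NonZero ρ}} → ∀ d → B d 0 ≗ shift d onePS
  B-initial d n with position d n
  ... | below n<d = trans (cong₂ _-_ (F-below d 0 n n<d) (shift-vanish ρ (F ρ d 0) n early))
                          (sym (shift-below d onePS n n<d))
    where
      early : ∀ m → ρ +ℕ m ≡ n → F ρ d 0 m ≡ 0ℤ
      early m e = F-below d 0 m (ℕP.≤-<-trans (ℕP.m≤n+m m ρ) (subst (_< d) (sym e) n<d))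
  ... | above m with position ρ m
  ...   | below m<ρ = begin
      F ρ d 0 (d +ℕ m) - shift ρ (F ρ d 0) (d +ℕ m)  ≡⟨ cong₂ _-_ (F₀-initial d m m<ρ) (shift-vanish ρ (F ρ d 0) (d +ℕ m) early) ⟩
      onePS m - 0ℤ                                   ≡⟨ ℤP.+-identityʳ (onePS m) ⟩
      onePS m                                        ≡⟨ sym (shift-at d onePS m) ⟩
      shift d onePS (d +ℕ m)                         ∎
    where
      open ≡-Reasoning
      early : ∀ m' → ρ +ℕ m' ≡ d +ℕ m → F ρ d 0 m' ≡ 0ℤ
      early m' e = F-below d 0 m' (ℕP.+-cancelˡ-< ρ m' d
        (subst (_< ρ +ℕ d) (sym e) (subst (d +ℕ m <_) (ℕP.+-comm d ρ) (ℕP.+-monoʳ-< d m<ρ))))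
  ...   | above m' = begin
      F ρ d 0 (d +ℕ (ρ +ℕ m')) - shift ρ (F ρ d 0) (d +ℕ (ρ +ℕ m'))  ≡⟨ cong₂ _-_ (F₀-periodic d m') shifted ⟩
      F ρ d 0 (d +ℕ m') - F ρ d 0 (d +ℕ m')                          ≡⟨ ℤP.+-inverseʳ (F ρ d 0 (d +ℕ m')) ⟩
      0ℤ                                                             ≡⟨ sym (onePS-nonzero (λ e → ≢-nonZero⁻¹ ρ (ℕP.m+n≡0⇒m≡0 ρ e))) ⟩
      onePS (ρ +ℕ m')                                                ≡⟨ sym (shift-at d onePS (ρ +ℕ m')) ⟩
      shift d onePS (d +ℕ (ρ +ℕ m'))                                 ∎
    where
      open ≡-Reasoning
      reassoc : d +ℕ (ρ +ℕ m') ≡ ρ +ℕ (d +ℕ m')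
      reassoc = trans (sym (ℕP.+-assoc d ρ m')) (trans (cong (_+ℕ m') (ℕP.+-comm d ρ)) (ℕP.+-assoc ρ d m'))
      shifted : shift ρ (F ρ d 0) (d +ℕ (ρ +ℕ m')) ≡ F ρ d 0 (d +ℕ m')
      shifted = trans (cong (shift ρ (F ρ d 0)) reassoc) (shift-at ρ (F ρ d 0) (d +ℕ m'))

  B-step : ∀ d k → B d (suc k) ≗ (λ n → M (θ (B d k)) n + κ k * shift ρ (B d k) n)
  B-step d k n = begin
    M (M^ (suc k) (F ρ d (suc k))) n                           ≡⟨ M-cong (M^-cong (suc k) (λ i → sym (θ-F d k i))) n ⟩
    M (M^ (suc k) (θ Fₖ)) n                                    ≡⟨ M-cong (M^-θ k Fₖ) n ⟩
    M (λ i → θ (B d k) i + κ k * shift ρ (M^ k Fₖ) i) n        ≡⟨ M-affine (κ k) (θ (B d k)) _ n ⟩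
    M (θ (B d k)) n + κ k * M (shift ρ (M^ k Fₖ)) n            ≡⟨ cong (λ z → M (θ (B d k)) n + κ k * z) (sym (M-shift (M^ k Fₖ) n)) ⟩
    M (θ (B d k)) n + κ k * shift ρ (B d k) n                  ∎
    where
      open ≡-Reasoning
      Fₖ : PS
      Fₖ = F ρ d k

  bound : ℕ → ℕ → ℕ
  bound d zero    = d +ℕ 1
  bound d (suc k) = ρ +ℕ bound d k

  bound-mono : ∀ {d d'} k → d ≤ d' → bound d k ≤ bound d' k
  bound-mono zero    d≤d' = ℕP.+-monoˡ-≤ 1 d≤d'
  bound-mono (suc k) d≤d' = ℕP.+-monoʳ-≤ ρ (bound-mono k d≤d')

  vanish-M : ∀ N X → VanishesFrom N X → VanishesFrom (ρ +ℕ N) (M X)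
  vanish-M N X v n le rewrite v n (ℕP.≤-trans (ℕP.m≤n+m N ρ) le) | vanish-shift ρ N X v n le = refl

  B-vanishes : .{{_ : NonZero ρ}} → ∀ d k → VanishesFrom (bound d k) (B d k)
  B-vanishes d zero    n le = trans (B-initial d n) (vanish-shift d 1 onePS onePS-vanishes n le)
  B-vanishes d (suc k) n le
    rewrite B-step d k n
          | vanish-M (bound d k) (θ (B d k)) (vanish-θ (bound d k) (B d k) (B-vanishes d k)) n le
          | vanish-shift ρ (bound d k) (B d k) (B-vanishes d k) n le
          | ℤP.*-zeroʳ (κ k) = refl

  ∇ : (ℕ → ℤ) → ℕ → ℤ
  ∇ p n = p n - p (ρ +ℕ n)

  moment-M : ∀ N p X → VanishesFrom N X → moment (ρ +ℕ N) p (M X) ≡ moment N (∇ p) X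
  moment-M N p X v = begin
    moment (ρ +ℕ N) p (M X)                                    ≡⟨ moment-sub (ρ +ℕ N) p X (shift ρ X) ⟩
    moment (ρ +ℕ N) p X - moment (ρ +ℕ N) p (shift ρ X)        ≡⟨ cong₂ _-_ (moment-truncate p X v (ℕP.m≤n+m N ρ)) (moment-shift ρ N p X) ⟩
    moment N p X - moment N (λ n → p (ρ +ℕ n)) X               ≡⟨ sym (weight-sub N p _ X) ⟩
    moment N (∇ p) X                                           ∎
    where open ≡-Reasoning

  -- The dual of the recurrence acts on weights by T k, and C k composes them.
  T : ℕ → (ℕ → ℤ) → ℕ → ℤ
  T i p n = + n * ∇ p n + κ i * p (ρ +ℕ n)

  C : ℕ → (ℕ → ℤ) → ℕ → ℤ
  C zero    p = p
  C (suc k) p = C k (T k p)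

  moment-B-step : .{{_ : NonZero ρ}} → ∀ d k p →
                  moment (bound d (suc k)) p (B d (suc k)) ≡ moment (bound d k) (T k p) (B d k)
  moment-B-step d k p = begin
    moment (ρ +ℕ N) p (B d (suc k))                                         ≡⟨ moment-cong (ρ +ℕ N) p (B-step d k) ⟩
    moment (ρ +ℕ N) p (λ n → M (θ Bₖ) n + κ k * shift ρ Bₖ n)               ≡⟨ moment-affine (ρ +ℕ N) p (κ k) _ _ ⟩
    moment (ρ +ℕ N) p (M (θ Bₖ)) + κ k * moment (ρ +ℕ N) p (shift ρ Bₖ)     ≡⟨ cong₂ (λ a b → a + κ k * b) (moment-M N p (θ Bₖ) (vanish-θ N Bₖ (B-vanishes d k))) (moment-shift ρ N p Bₖ) ⟩
    moment N (∇ p) (θ Bₖ) + κ k * moment N (λ n → p (ρ +ℕ n)) Bₖ            ≡⟨ cong (λ a → a + κ k * moment N (λ n → p (ρ +ℕ n)) Bₖ) (moment-θ N (∇ p) Bₖ) ⟩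
    moment N (λ n → + n * ∇ p n) Bₖ + κ k * moment N (λ n → p (ρ +ℕ n)) Bₖ  ≡⟨ sym (weight-affine N (κ k) (λ n → + n * ∇ p n) (λ n → p (ρ +ℕ n)) Bₖ) ⟩
    moment N (T k p) Bₖ                                                     ∎
    where
      open ≡-Reasoning
      N : ℕ
      N = bound d k
      Bₖ : PS
      Bₖ = B d k

  moment-B : .{{_ : NonZero ρ}} → ∀ d k p → moment (bound d k) p (B d k) ≡ C k p d
  moment-B d zero    p = begin
    moment (d +ℕ 1) p (B d 0)                     ≡⟨ moment-cong (d +ℕ 1) p (B-initial d) ⟩
    moment (d +ℕ 1) p (shift d onePS)             ≡⟨ moment-shift d 1 p onePS ⟩
    0ℤ + p (d +ℕ 0) * 1ℤ                          ≡⟨ trans (ℤP.+-identityˡ _) (ℤP.*-identityʳ _) ⟩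
    p (d +ℕ 0)                                    ≡⟨ cong p (ℕP.+-identityʳ d) ⟩
    p d                                           ∎
    where open ≡-Reasoning
  moment-B d (suc k) p = trans (moment-B-step d k p) (moment-B d k (T k p))

  -- Each T i lowers the degree of a weight by one: the top differences of
  -- n ↦ n ∇p(n) and of (i+1) ρ p(n+ρ) cancel.
  T-lowers-degree : ∀ i p → DegreeAtMost (suc i) p → DegreeAtMost i (T i p)
  T-lowers-degree i p deg n = begin
    Δ^ (suc i) (T i p) n
      ≡⟨ Δ^-+ (suc i) (λ x → + x * ∇ p x) (λ x → κ i * p (ρ +ℕ x)) n ⟩
    Δ^ (suc i) (λ x → + x * ∇ p x) n + Δ^ (suc i) (λ x → κ i * p (ρ +ℕ x)) n
      ≡⟨ cong₂ _+_ (Leibniz i (∇ p) n) (trans (Δ^-scale (suc i) (κ i) (λ x → p (ρ +ℕ x)) n) (cong (κ i *_) (Δ^-translate (suc i) ρ p n))) ⟩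
    (+ n * Δ^ (suc i) (∇ p) n + + suc i * Δ^ i (∇ p) (suc n)) + κ i * G (ρ +ℕ n)
      ≡⟨ cong₂ (λ u v → (+ n * u + + suc i * v) + κ i * G (ρ +ℕ n)) (∇-top n) (∇-below-top (suc n)) ⟩
    (+ n * 0ℤ + + suc i * - (+ ρ * G 0)) + κ i * G (ρ +ℕ n)
      ≡⟨ cong₂ (λ c g → (+ n * 0ℤ + + suc i * - (+ ρ * G 0)) + c * g) (ℤP.pos-* (suc i) ρ) (G-constant (ρ +ℕ n)) ⟩
    (+ n * 0ℤ + + suc i * - (+ ρ * G 0)) + (+ suc i * + ρ) * G 0
      ≡⟨ cancel (+ n) (+ suc i) (+ ρ) (G 0) ⟩
    0ℤ ∎
    where
      open ≡-Reasoning
      G : ℕ → ℤ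
      G = Δ^ (suc i) p
      G-constant : ∀ x → G x ≡ G 0
      G-constant = Δ-zero⇒constant G deg
      ∇-differences : ∀ m x → Δ^ m (∇ p) x ≡ Δ^ m p x - Δ^ m p (ρ +ℕ x)
      ∇-differences m x = trans (Δ^-sub m p (λ y → p (ρ +ℕ y)) x) (cong (λ z → Δ^ m p x - z) (Δ^-translate m ρ p x))
      ∇-top : ∀ x → Δ^ (suc i) (∇ p) x ≡ 0ℤ
      ∇-top x = trans (∇-differences (suc i) x) (trans (cong₂ _-_ (G-constant x) (G-constant (ρ +ℕ x))) (ℤP.+-inverseʳ (G 0)))
      ∇-below-top : ∀ x → Δ^ i (∇ p) x ≡ - (+ ρ * G 0)
      ∇-below-top x = trans (∇-differences i x)
        (trans (cong (λ z → Δ^ i p x - z) (Δ-constant⇒linear (Δ^ i p) (G 0) G-constant ρ x)) (drop (Δ^ i p x) (+ ρ * G 0)))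
        where
          drop : ∀ h g → h - (h + g) ≡ - g
          drop = solve-∀
      cancel : ∀ n s r g → (n * 0ℤ + s * - (r * g)) + (s * r) * g ≡ 0ℤ
      cancel = solve-∀

  C-constant : ∀ k p → DegreeAtMost k p → ∀ n → C k p n ≡ C k p 0
  C-constant zero    p deg = Δ-zero⇒constant p deg
  C-constant (suc k) p deg = C-constant k (T k p) (T-lowers-degree k p deg)

  T-at-multiple : ∀ k p m r a b → m +ℕ r ≡ k → p (m *ℕ ρ) ≡ + a → p (suc m *ℕ ρ) ≡ + b →
                  T k p (m *ℕ ρ) ≡ + (m *ℕ ρ *ℕ a +ℕ suc r *ℕ ρ *ℕ b)
  T-at-multiple k p m r a b m+r≡k pa pb = begin
    + x * (p x - p (ρ +ℕ x)) + κ k * p (ρ +ℕ x)    ≡⟨ cong₂ (λ u v → + x * (u - v) + κ k * v) pa pb ⟩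
    + x * (+ a - + b) + κ k * + b                   ≡⟨ cong (λ c → + x * (+ a - + b) + c * + b) κ-split ⟩
    + x * (+ a - + b) + (+ x + + y) * + b           ≡⟨ combine (+ x) (+ y) (+ a) (+ b) ⟩
    + x * + a + + y * + b                           ≡⟨ sym (cong₂ _+_ (ℤP.pos-* x a) (ℤP.pos-* y b)) ⟩
    + (x *ℕ a) + + (y *ℕ b)                         ≡⟨ sym (ℤP.pos-+ (x *ℕ a) (y *ℕ b)) ⟩
    + (x *ℕ a +ℕ y *ℕ b)                            ∎
    where
      open ≡-Reasoning
      x y : ℕ
      x = m *ℕ ρ
      y = suc r *ℕ ρ
      κ-split : κ k ≡ + x + + y
      κ-split = trans (cong (λ j → + (suc j *ℕ ρ)) (sym m+r≡k))
        (trans (cong +_ (trans (cong (_*ℕ ρ) (sym (ℕP.+-suc m r))) (ℕP.*-distribʳ-+ ρ m (suc r)))) (ℤP.pos-+ x y))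
      combine : ∀ x y a b → x * (a - b) + (x + y) * b ≡ x * a + y * b
      combine = solve-∀

  C-positive : .{{_ : NonZero ρ}} → ∀ k p →
               (∀ m → m ≤ k → ∃ λ a → p (m *ℕ ρ) ≡ + a) →
               (∃ λ a → p (k *ℕ ρ) ≡ + suc a) →
               ∃ λ a → C k p 0 ≡ + suc a
  C-positive zero    p naturals top       = top
  C-positive (suc k) p naturals (b , pb) = C-positive k (T k p) naturals-T top-T
    where
      naturals-T : ∀ m → m ≤ k → ∃ λ c → T k p (m *ℕ ρ) ≡ + c
      naturals-T m m≤k with ℕP.m≤n⇒∃[o]m+o≡n m≤k | naturals m (ℕP.m≤n⇒m≤1+n m≤k) | naturals (suc m) (s≤s m≤k)
      ... | r , m+r≡k | a , pa | a' , pa' = _ , T-at-multiple k p m r a a' m+r≡k pa pa'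
      -- the second summand ρ · p((k+1)ρ) is positive
      top-T : ∃ λ c → T k p (k *ℕ ρ) ≡ + suc c
      top-T with naturals k (ℕP.m≤n⇒m≤1+n ℕP.≤-refl)
      ... | a , pa with positive⇒suc (ℕP.<-≤-trans (>-nonZero⁻¹ _ {{ℕP.m*n≢0 (1 *ℕ ρ) (suc b) {{ℕP.m*n≢0 1 ρ}}}})
                                                      (ℕP.m≤n+m (1 *ℕ ρ *ℕ suc b) (k *ℕ ρ *ℕ a)))
      ...   | c , v≡suc = c , trans (T-at-multiple k p k 0 a (suc b) (ℕP.+-identityʳ k) pa pb) (cong +_ v≡suc)

  q-vanishes : .{{_ : NonZero ρ}} → ∀ d k → d ≤ ρ → VanishesFrom (bound ρ k) (q ρ d k)
  q-vanishes d k d≤ρ n le = trans (q≗B d k n) (B-vanishes d k n (ℕP.≤-trans (bound-mono k d≤ρ) le))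

  q-derivative : .{{_ : NonZero ρ}} → ∀ d k j → d ≤ ρ → j ≤ k →
                 deriv1 (bound ρ k) (q ρ d k) j ≡ C k (fallingWeight j) 0
  q-derivative d k j d≤ρ j≤k = begin
    moment (bound ρ k) (fallingWeight j) (q ρ d k)   ≡⟨ moment-cong (bound ρ k) (fallingWeight j) (q≗B d k) ⟩
    moment (bound ρ k) (fallingWeight j) (B d k)     ≡⟨ moment-truncate (fallingWeight j) (B d k) (B-vanishes d k) (bound-mono k d≤ρ) ⟩
    moment (bound d k) (fallingWeight j) (B d k)     ≡⟨ moment-B d k (fallingWeight j) ⟩
    C k (fallingWeight j) d                          ≡⟨ C-constant k (fallingWeight j) (degree-mono (fallingWeight j) j≤k (fallingWeight-degree j)) d ⟩
    C k (fallingWeight j) 0                          ∎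
    where open ≡-Reasoning

  C-fallingWeight-positive : .{{_ : NonZero ρ}} → ∀ k j → j ≤ k → ∃ λ a → C k (fallingWeight j) 0 ≡ + suc a
  C-fallingWeight-positive k j j≤k with positive⇒suc (ff-positive (k *ℕ ρ) j (ℕP.≤-trans j≤k (ℕP.m≤m*n k ρ)))
  ... | a , top = C-positive k (fallingWeight j) (λ m _ → ff (m *ℕ ρ) j , refl) (a , cong +_ top)

proposition2p6 : (ρ k : ℕ) → 1 ≤ ρ →
    Σ ℕ (λ N →
      ((d : ℕ) → 1 ≤ d → d ≤ ρ → (n : ℕ) → N ≤ n → q ρ d k n ≡ 0ℤ)
      × ((j : ℕ) → j ≤ k →
          (deriv1 N (q ρ 1 k) j ≢ 0ℤ)
          × ((d : ℕ) → 1 ≤ d → d ≤ ρ → deriv1 N (q ρ d k) j ≡ deriv1 N (q ρ 1 k) j)))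
proposition2p6 ρ k 1≤ρ = bound ρ k , (λ d _ d≤ρ → q-vanishes d k d≤ρ) , derivatives
  where
    instance
      ρ-nonZero : NonZero ρ
      ρ-nonZero = >-nonZero 1≤ρ
    open Period ρ
    derivatives : (j : ℕ) → j ≤ k →
                  (deriv1 (bound ρ k) (q ρ 1 k) j ≢ 0ℤ)
                  × ((d : ℕ) → 1 ≤ d → d ≤ ρ → deriv1 (bound ρ k) (q ρ d k) j ≡ deriv1 (bound ρ k) (q ρ 1 k) j)
    derivatives j j≤k = nonzero , independent
      where
        nonzero : deriv1 (bound ρ k) (q ρ 1 k) j ≢ 0ℤ
        nonzero e with C-fallingWeight-positive k j j≤k
        ... | a , positive = suc≢0 (trans (sym positive) (trans (sym (q-derivative 1 k j 1≤ρ j≤k)) e))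
          where
            suc≢0 : ∀ {a} → + suc a ≢ 0ℤ
            suc≢0 ()
        independent : (d : ℕ) → 1 ≤ d → d ≤ ρ → deriv1 (bound ρ k) (q ρ d k) j ≡ deriv1 (bound ρ k) (q ρ 1 k) j
        independent d _ d≤ρ = trans (q-derivative d k j d≤ρ j≤k) (sym (q-derivative 1 k j 1≤ρ j≤k))
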